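{- Let $p$ be an odd prime and $m\le n$ positive integers. For $1\le i\le m$ let $t_i\in\mathbb{N}$ and $$g_i(\alpha_1,\dots,\alpha_n)=\sum_{j=1}^{t_i}a_j^{(i)}\big(x_j^{(i1)}\big)^{\alpha_1}\cdots\big(x_j^{(in)}\big)^{\alpha_n},$$ with $a_j^{(i)}\in\mathbb{Z}_p$ and $x_j^{(i\ell)}=\overline{(x_{jk}^{(i\ell)})}_k\in\mathbb{Z}_p^\times$, viewed as functions of $(\alpha_1,\dots,\alpha_n)\in\mathcal{E}_p^n$, and set $\mathbf{g}=(g_1,\dots,g_m)$. Let $\mathbf{y}=(y_1,\dots,y_m)\in\mathbb{Z}_p^m$ and let $\boldsymbol{\alpha}_1=(\alpha_{11},\dots,\alpha_{n1})\in\mathbb{Z}^n$ be such that (i) $\mathbf{g}(\boldsymbol{\alpha}_1)\equiv\mathbf{y}\pmod p$ (coordinatewise), and (ii) the $m\times n$ matrix $J_p\mathbf{g}(\boldsymbol{\alpha}_1)\in(\mathbb{Z}/p\mathbb{Z})^{m\times n}$ with $(i,\ell)$ entry $$\sum_{j=1}^{t_i}a_j^{(i)}\,e_2\big(x_{j2}^{(i\ell)}\big)\,\big(x_j^{(i1)}\big)^{\alpha_{11}}\cdots\big(x_j^{(in)}\big)^{\alpha_{n1}}\pmod p$$ has rank $m$. Then there exists $\boldsymbol{\alpha}=(\alpha_1,\dots,\alpha_n)\in\mathcal{E}_p^n$ with $\alpha_\ell=\overline{(\alpha_{\ell1},\dots)}$ (first coordinate $\alpha_{\ell1}$) for $1\le\ell\le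 n$ such that $\mathbf{g}(\boldsymbol{\alpha})=\mathbf{y}$ in $\mathbb{Z}_p^m$.
   Context: $\mathbb{Z}_p$ is modeled as the set of sequences $(a_k)_{k\in\mathbb{N}}$ of integers with $a_{k+1}\equiv a_k\pmod{p^k}$, modulo $a_k\equiv b_k\pmod{p^k}$ for all $k$, coordinatewise operations; units: $p\nmid a_1$; congruence modulo $p$ refers to first coordinates. $\mathcal{E}_p$ is the set of sequences $(\alpha_k)_{k\in\mathbb{N}}$ of integers with $\alpha_{k+1}\equiv\alpha_k\pmod{\varphi(p^k)}$, modulo $\alpha_k\equiv\beta_k\pmod{\varphi(p^k)}$ for all $k$ ($\varphi$ = Euler's totient). For $a=\overline{(a_k)}\in\mathbb{Z}_p^\times$ and $\alpha=\overline{(\alpha_k)}\in\mathcal{E}_p$, $a^\alpha:=\overline{(a_k^{\alpha_k})}$; integers are embedded as constant sequences. $e_2:(\mathbb{Z}/p^2\mathbb{Z})^\times\to\mathbb{Z}/p\mathbb{Z}$ is defined by $x^{p-1}\equiv1+p\,e_2(x)\pmod{p^2}$. -}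

module Defs where

open import Data.Nat as ℕ using (ℕ; zero; suc)
open import Data.Integer as ℤ using (ℤ; +_; -[1+_]; _*_; _+_; _-_)
open import Data.Integer.Divisibility using (_∣_)
open import Data.Fin using (Fin; zero; suc)
open import Data.List using (length; filter; map; upTo)
open import Data.Nat.Coprimality using (coprime?)
open import Relation.Binary.PropositionalEquality using (_≡_)
open import Relation.Nullary using (¬_)

infix 4 _≡_[mod_]
_≡_[mod_] : ℤ → ℤ → ℕ → Set
a ≡ b [mod n ] = (+ n) ∣ (a - b)

φ : ℕ → ℕ
φ n = length (filter (λ i → coprime? i n) (map suc (upTo n)))

Σ[_] : (t : ℕ) → (Fin t → ℤ) → ℤ
Σ[ zero ] f = + 0
Σ[ suc t ] f = f zero + Σ[ t ] (λ j → f (suc j))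

Π[_] : (t : ℕ) → (Fin t → ℤ) → ℤ
Π[ zero ] f = + 1
Π[ suc t ] f = f zero * Π[ t ] (λ j → f (suc j))

-- NOTE on indexing: a sequence (a_k)_{k ≥ 1} is stored as s : ℕ → ℤ
-- with s k = a_{k+1}; so s 0 is the first coordinate a_1.

record ℤp (p : ℕ) : Set where
  field
    seq : ℕ → ℤ
    coh : ∀ k → seq (suc k) ≡ seq k [mod p ℕ.^ suc k ]
open ℤp public

record ℤpˣ (p : ℕ) : Set where
  field
    elt  : ℤp p
    unit : ¬ ((+ p) ∣ seq elt 0)
open ℤpˣ public

record 𝓔 (p : ℕ) : Set where
  field
    eseq : ℕ → ℤ
    ecoh : ∀ k → eseq (suc k) ≡ eseq k [mod φ (p ℕ.^ suc k) ]
open 𝓔 public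

-- PowMod M a e c : c represents a^e in (ℤ/Mℤ)^× (e ∈ ℤ; for e = -(n+1),
-- c is the class with c · a^(n+1) ≡ 1, i.e. (a^{-1})^{n+1}).
PowMod : ℕ → ℤ → ℤ → ℤ → Set
PowMod M a (+ n)     c = c ≡ a ℤ.^ n [mod M ]
PowMod M a -[1+ n ]  c = (c * a ℤ.^ suc n) ≡ + 1 [mod M ]

-- E2 p x e : e represents e₂(x), i.e. x^(p-1) ≡ 1 + p·e (mod p²).
E2 : ℕ → ℤ → ℤ → Set
E2 p x e = x ℤ.^ (p ℕ.∸ 1) ≡ (+ 1 + (+ p) * e) [mod p ℕ.^ 2 ]

HasRankModP : (p m n : ℕ) → (Fin m → Fin n → ℤ) → Set
HasRankModP p m n M =
  (c : Fin m → ℤ) →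
  (∀ ℓ → Σ[ m ] (λ i → c i * M i ℓ) ≡ + 0 [mod p ]) →
  ∀ i → c i ≡ + 0 [mod p ]

{-# OPTIONS --safe #-}
module Submission where

-- Hensel lifting in the exponent. At level k we keep natural-number exponents
-- β ≡ α₁ (mod p − 1) with g(β) ≡ y (mod p^(k+1)). At level k + 1 the old β
-- leaves a residual p^(k+1)·D. For odd p, x^(p^k(p−1)) ≡ 1 + p^(k+1)·e₂(x)
-- (mod p^(k+2)), so replacing β by β + p^k(p−1)·γ changes g by p^(k+1)·Jγ
-- modulo p^(k+2), where J is the Jacobian of the hypothesis: its entries only
-- matter mod p, and mod p every x^β equals x^α₁. Since J has full row rank
-- mod p we can solve Jγ ≡ −D. All changes are multiples of
-- p^k(p−1) = φ(p^(k+1)), so the exponents form an element of 𝓔_p whose first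
-- coordinate is α₁.

open import Defs
open import Data.Nat as ℕ using (ℕ; zero; suc; _≤_)
open import Data.Nat.Divisibility as ℕ using ()
import Data.Nat.Properties as ℕP
import Data.Nat.Divisibility as ℕD
open import Data.Nat.Primality using (Prime; prime⇒nonZero; prime⇒nonTrivial; prime⇒irreducible)
open import Data.Nat.Coprimality using (Coprime; coprime-divisor; coprime-Bézout; prime⇒coprime)
open import Data.Nat.GCD using (module Bézout)
open import Data.Nat.Combinatorics using (_C_; nC1≡n; nCk+nC[k+1]≡[n+1]C[k+1])
import Data.Nat.Tactic.RingSolver as ℕ-Solver
open import Data.Integer as ℤ using (ℤ; +_; -[1+_]; _*_; _+_; _-_; -_; 0ℤ; 1ℤ; _^_)
import Data.Integer.Properties as ℤP
import Data.Integer.Divisibility.Signed as ℤS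
open import Data.Integer.Divisibility.Signed using (divides; ∣ᵤ⇒∣; ∣⇒∣ᵤ)
open import Data.Integer.DivMod using (_%ℕ_; _/ℕ_; n%ℕd<d; a≡a%ℕn+[a/ℕn]*n)
open import Data.Integer.Tactic.RingSolver using (solve-∀)
open import Data.Fin using (Fin; zero; suc)
open import Data.Fin.Properties using (¬∀⟶∃¬)
open import Data.List using ([_]; _++_; length; filter; map; upTo)
open import Data.List.Properties
  using (upTo-∷ʳ; map-++; filter-++; length-++; filter-≐; filter-accept; filter-reject)
open import Data.Product using (Σ; ∃-syntax; _×_; _,_; proj₁; proj₂)
open import Data.Sum using (_⊎_; inj₁; inj₂)
open import Function using (_∘_)
open import Level using (0ℓ)
open import Relation.Binary.Bundles using (Setoid)
open import Relation.Binary.PropositionalEquality as ≡ using (_≡_; module ≡-Reasoning)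
import Relation.Binary.Reasoning.Setoid as SetoidReasoning
open import Relation.Nullary using (Dec; ¬_; contradiction)
open import Relation.Nullary.Decidable using (map′; ¬?)
open import Relation.Unary using (Decidable; _≐_)
open import Algebra.Properties.Semiring.Sum ℤP.+-*-semiring
  using (sum; sum-cong-≗; ∑-distrib-+; ∑-comm; *-distribˡ-sum)

-- Congruences modulo an integer

-- The quotient is explicit so that the identities behind congruences can be
-- left to the ring solver.
infix 4 _≡_⟨mod_⟩

record _≡_⟨mod_⟩ (a b N : ℤ) : Set where
  constructor _,_
  field
    quotient : ℤ
    equation : a ≡ b + quotient * N

open _≡_⟨mod_⟩ using (quotient; equation)

module Mod where

  reflexive : ∀ {N a b} → a ≡ b → a ≡ b ⟨mod N ⟩
  reflexive {N} {a} ≡.refl = 0ℤ , ≡.sym (lemma a N)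
    where
    lemma : ∀ a N → a + 0ℤ * N ≡ a
    lemma = solve-∀

  refl : ∀ {N a} → a ≡ a ⟨mod N ⟩
  refl = reflexive ≡.refl

  sym : ∀ {N a b} → a ≡ b ⟨mod N ⟩ → b ≡ a ⟨mod N ⟩
  sym {N} {b = b} (q , ≡.refl) = - q , lemma b q N
    where
    lemma : ∀ b q N → b ≡ b + q * N + - q * N
    lemma = solve-∀

  trans : ∀ {N a b c} → a ≡ b ⟨mod N ⟩ → b ≡ c ⟨mod N ⟩ → a ≡ c ⟨mod N ⟩
  trans {N} {c = c} (q , ≡.refl) (r , ≡.refl) = r + q , lemma c q r N
    where
    lemma : ∀ c q r N → c + r * N + q * N ≡ c + (r + q) * N
    lemma = solve-∀

  setoid : ℤ → Setoid 0ℓ 0ℓ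
  setoid N = record
    { Carrier       = ℤ
    ; _≈_           = λ a b → a ≡ b ⟨mod N ⟩
    ; isEquivalence = record { refl = refl ; sym = sym ; trans = trans }
    }

  multiple : ∀ {N} a q → a + q * N ≡ a ⟨mod N ⟩
  multiple a q = q , ≡.refl

  +-cong : ∀ {N a b c d} → a ≡ b ⟨mod N ⟩ → c ≡ d ⟨mod N ⟩ → a + c ≡ b + d ⟨mod N ⟩
  +-cong {N} {b = b} {d = d} (q , ≡.refl) (r , ≡.refl) = q + r , lemma b d q r N
    where
    lemma : ∀ b d q r N → b + q * N + (d + r * N) ≡ b + d + (q + r) * N
    lemma = solve-∀

  +-congˡ : ∀ {N} c {a b} → a ≡ b ⟨mod N ⟩ → c + a ≡ c + b ⟨mod N ⟩
  +-congˡ c = +-cong (refl {a = c})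

  -‿cong : ∀ {N a b} → a ≡ b ⟨mod N ⟩ → - a ≡ - b ⟨mod N ⟩
  -‿cong {N} {b = b} (q , ≡.refl) = - q , lemma b q N
    where
    lemma : ∀ b q N → - (b + q * N) ≡ - b + - q * N
    lemma = solve-∀

  *-cong : ∀ {N a b c d} → a ≡ b ⟨mod N ⟩ → c ≡ d ⟨mod N ⟩ → a * c ≡ b * d ⟨mod N ⟩
  *-cong {N} {b = b} {d = d} (q , ≡.refl) (r , ≡.refl) =
    q * d + b * r + q * r * N , lemma b d q r N
    where
    lemma : ∀ b d q r N → (b + q * N) * (d + r * N) ≡ b * d + (q * d + b * r + q * r * N) * N
    lemma = solve-∀

  *-congˡ : ∀ {N} c {a b} → a ≡ b ⟨mod N ⟩ → c * a ≡ c * b ⟨mod N ⟩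
  *-congˡ c = *-cong (refl {a = c})

  *-congʳ : ∀ {N} c {a b} → a ≡ b ⟨mod N ⟩ → a * c ≡ b * c ⟨mod N ⟩
  *-congʳ c a≡b = *-cong a≡b (refl {a = c})

  ^-cong : ∀ {N a b} k → a ≡ b ⟨mod N ⟩ → a ^ k ≡ b ^ k ⟨mod N ⟩
  ^-cong zero    a≡b = refl
  ^-cong (suc k) a≡b = *-cong a≡b (^-cong k a≡b)

  Σ-cong : ∀ {N} t {f g : Fin t → ℤ} → (∀ j → f j ≡ g j ⟨mod N ⟩) →
           Σ[ t ] f ≡ Σ[ t ] g ⟨mod N ⟩
  Σ-cong zero    f≡g = refl
  Σ-cong (suc t) f≡g = +-cong (f≡g zero) (Σ-cong t (f≡g ∘ suc))

  Π-cong : ∀ {N} t {f g : Fin t → ℤ} → (∀ j → f j ≡ g j ⟨mod N ⟩) →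
           Π[ t ] f ≡ Π[ t ] g ⟨mod N ⟩
  Π-cong zero    f≡g = refl
  Π-cong (suc t) f≡g = *-cong (f≡g zero) (Π-cong t (f≡g ∘ suc))

  scale : ∀ {N} c {a b} → a ≡ b ⟨mod N ⟩ → c * a ≡ c * b ⟨mod N * c ⟩
  scale {N} c {b = b} (q , ≡.refl) = q , lemma b q c N
    where
    lemma : ∀ b q c N → c * (b + q * N) ≡ c * b + q * (N * c)
    lemma = solve-∀

  weaken : ∀ {N M a b} → N ℤS.∣ M → a ≡ b ⟨mod M ⟩ → a ≡ b ⟨mod N ⟩
  weaken {N} {b = b} (divides k ≡.refl) (q , ≡.refl) = q * k , lemma b q k N
    where
    lemma : ∀ b q k N → b + q * (k * N) ≡ b + q * k * N
    lemma = solve-∀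

  modulus-cong : ∀ {N M a b} → N ≡ M → a ≡ b ⟨mod N ⟩ → a ≡ b ⟨mod M ⟩
  modulus-cong ≡.refl a≡b = a≡b

module ≡-mod-Reasoning (N : ℤ) = SetoidReasoning (Mod.setoid N)

∣⇒≡-mod : ∀ {N a b} → N ℤS.∣ a - b → a ≡ b ⟨mod N ⟩
∣⇒≡-mod {a = a} {b} (divides q a-b≡qN) = q , ≡.trans (lemma a b) (≡.cong (_+_ b) a-b≡qN)
  where
  lemma : ∀ a b → a ≡ b + (a - b)
  lemma = solve-∀

≡-mod⇒∣ : ∀ {N a b} → a ≡ b ⟨mod N ⟩ → N ℤS.∣ a - b
≡-mod⇒∣ {N} {b = b} (q , ≡.refl) = divides q (lemma b q N)
  where
  lemma : ∀ b q N → b + q * N - b ≡ q * N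
  lemma = solve-∀

_≟_⟨mod_⟩ : ∀ a b N → Dec (a ≡ b ⟨mod N ⟩)
a ≟ b ⟨mod N ⟩ = map′ ∣⇒≡-mod ≡-mod⇒∣ (N ℤS.∣? (a - b))

[mod]⇒⟨mod⟩ : ∀ {a b n} → a ≡ b [mod n ] → a ≡ b ⟨mod + n ⟩
[mod]⇒⟨mod⟩ = ∣⇒≡-mod ∘ ∣ᵤ⇒∣

⟨mod⟩⇒[mod] : ∀ {a b n} → a ≡ b ⟨mod + n ⟩ → a ≡ b [mod n ]
⟨mod⟩⇒[mod] = ∣⇒∣ᵤ ∘ ≡-mod⇒∣

pos-+* : ∀ v r d → + (v ℕ.+ r ℕ.* d) ≡ + v + + r * + d
pos-+* v r d = ≡.trans (ℤP.pos-+ v (r ℕ.* d)) (≡.cong (_+_ (+ v)) (ℤP.pos-* r d))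

pos-^ : ∀ m n → + (m ℕ.^ n) ≡ (+ m) ^ n
pos-^ m zero    = ≡.refl
pos-^ m (suc n) = ≡.trans (ℤP.pos-* m (m ℕ.^ n)) (≡.cong (_*_ (+ m)) (pos-^ m n))

-- Finite sums

Σ≡sum : ∀ t (f : Fin t → ℤ) → Σ[ t ] f ≡ sum f
Σ≡sum zero    f = ≡.refl
Σ≡sum (suc t) f = ≡.cong (_+_ (f zero)) (Σ≡sum t (f ∘ suc))

Σ-cong : ∀ t {f g : Fin t → ℤ} → (∀ j → f j ≡ g j) → Σ[ t ] f ≡ Σ[ t ] g
Σ-cong t {f} {g} f≗g = ≡.trans (Σ≡sum t f) (≡.trans (sum-cong-≗ f≗g) (≡.sym (Σ≡sum t g)))

Σ-distrib-+ : ∀ t (f g : Fin t → ℤ) → Σ[ t ] (λ j → f j + g j) ≡ Σ[ t ] f + Σ[ t ] g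
Σ-distrib-+ t f g = begin
  Σ[ t ] (λ j → f j + g j)  ≡⟨ Σ≡sum t _ ⟩
  sum (λ j → f j + g j)     ≡⟨ ∑-distrib-+ f g ⟩
  sum f + sum g             ≡⟨ ≡.cong₂ _+_ (Σ≡sum t f) (Σ≡sum t g) ⟨
  Σ[ t ] f + Σ[ t ] g       ∎
  where open ≡-Reasoning

*-distribˡ-Σ : ∀ t c (f : Fin t → ℤ) → c * Σ[ t ] f ≡ Σ[ t ] (λ j → c * f j)
*-distribˡ-Σ t c f = begin
  c * Σ[ t ] f              ≡⟨ ≡.cong (_*_ c) (Σ≡sum t f) ⟩
  c * sum f                 ≡⟨ *-distribˡ-sum c f ⟩
  sum (λ j → c * f j)       ≡⟨ Σ≡sum t _ ⟨
  Σ[ t ] (λ j → c * f j)    ∎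
  where open ≡-Reasoning

*-distribʳ-Σ : ∀ t c (f : Fin t → ℤ) → Σ[ t ] f * c ≡ Σ[ t ] (λ j → f j * c)
*-distribʳ-Σ t c f = begin
  Σ[ t ] f * c              ≡⟨ ℤP.*-comm (Σ[ t ] f) c ⟩
  c * Σ[ t ] f              ≡⟨ *-distribˡ-Σ t c f ⟩
  Σ[ t ] (λ j → c * f j)    ≡⟨ Σ-cong t (λ j → ℤP.*-comm c (f j)) ⟩
  Σ[ t ] (λ j → f j * c)    ∎
  where open ≡-Reasoning

Σ-comm : ∀ m n (f : Fin m → Fin n → ℤ) →
         Σ[ m ] (λ i → Σ[ n ] (f i)) ≡ Σ[ n ] (λ ℓ → Σ[ m ] (λ i → f i ℓ))
Σ-comm m n f = begin
  Σ[ m ] (λ i → Σ[ n ] (f i))             ≡⟨ Σ²≡sum² m n f ⟩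
  sum (λ i → sum (f i))                   ≡⟨ ∑-comm f ⟩
  sum (λ ℓ → sum (λ i → f i ℓ))           ≡⟨ Σ²≡sum² n m (λ ℓ i → f i ℓ) ⟨
  Σ[ n ] (λ ℓ → Σ[ m ] (λ i → f i ℓ))     ∎
  where
  open ≡-Reasoning
  Σ²≡sum² : ∀ m n (g : Fin m → Fin n → ℤ) →
            Σ[ m ] (λ i → Σ[ n ] (g i)) ≡ sum (λ i → sum (g i))
  Σ²≡sum² m n g = ≡.trans (Σ≡sum m _) (sum-cong-≗ (λ i → Σ≡sum n (g i)))

δ : ∀ {n} → Fin n → Fin n → ℤ
δ zero    zero    = 1ℤ
δ zero    (suc _) = 0ℤ
δ (suc _) zero    = 0ℤ
δ (suc a) (suc b) = δ a b

infix 8 _·_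

_·_ : ∀ {n} → (Fin n → ℤ) → (Fin n → ℤ) → ℤ
_·_ {n} u v = Σ[ n ] (λ ℓ → u ℓ * v ℓ)

δ-· : ∀ {n} (a : Fin n) (v : Fin n → ℤ) → δ a · v ≡ v a
δ-· {suc n} zero v = begin
  1ℤ * v zero + Σ[ n ] (λ ℓ → 0ℤ * v (suc ℓ))
    ≡⟨ ≡.cong (_+_ (1ℤ * v zero)) (*-distribˡ-Σ n 0ℤ (v ∘ suc)) ⟨
  1ℤ * v zero + 0ℤ * Σ[ n ] (v ∘ suc)
    ≡⟨ lemma (v zero) (Σ[ n ] (v ∘ suc)) ⟩
  v zero  ∎
  where
  open ≡-Reasoning
  lemma : ∀ a b → 1ℤ * a + 0ℤ * b ≡ a
  lemma = solve-∀
δ-· {suc n} (suc a) v =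
  ≡.trans (≡.cong (_+ δ a · (v ∘ suc)) (ℤP.*-zeroˡ (v zero)))
          (≡.trans (ℤP.+-identityˡ _) (δ-· a (v ∘ suc)))

·-δ : ∀ {n} (u : Fin n → ℤ) (a : Fin n) → u · δ a ≡ u a
·-δ {n} u a = ≡.trans (Σ-cong n (λ ℓ → ℤP.*-comm (u ℓ) (δ a ℓ))) (δ-· a u)

-- Linear systems modulo a prime

module LinearAlgebraModPrime (p : ℕ) (p-prime : Prime p) where

  private
    instance
      p-nonZero : ℕ.NonZero p
      p-nonZero = prime⇒nonZero p-prime
      p-nonTrivial : ℕ.NonTrivial p
      p-nonTrivial = prime⇒nonTrivial p-prime

  1≢0 : ¬ (1ℤ ≡ 0ℤ ⟨mod + p ⟩)
  1≢0 1≡0 = ℕ.nonTrivial⇒≢1 (ℕD.∣1⇒≡1 (⟨mod⟩⇒[mod] 1≡0))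

  inverse-of-residue : ∀ r → Bézout.Identity 1 p r → ∃[ u ] u * + r ≡ 1ℤ ⟨mod + p ⟩
  inverse-of-residue r (Bézout.+- x y 1+yr≡xp) = - (+ y) , (- (+ x) , (begin
    - (+ y) * + r             ≡⟨ lemma (+ y) (+ r) ⟩
    1ℤ - (1ℤ + + y * + r)     ≡⟨ ≡.cong (λ z → 1ℤ - z) 1+yr≡xp′ ⟩
    1ℤ - + x * + p            ≡⟨ lemma′ (+ x) (+ p) ⟩
    1ℤ + - (+ x) * + p        ∎))
    where
    open ≡-Reasoning
    1+yr≡xp′ : 1ℤ + + y * + r ≡ + x * + p
    1+yr≡xp′ = ≡.trans (≡.sym (pos-+* 1 y r)) (≡.trans (≡.cong +_ 1+yr≡xp) (ℤP.pos-* x p))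
    lemma : ∀ y r → - y * r ≡ 1ℤ - (1ℤ + y * r)
    lemma = solve-∀
    lemma′ : ∀ x p → 1ℤ - x * p ≡ 1ℤ + - x * p
    lemma′ = solve-∀
  inverse-of-residue r (Bézout.-+ x y 1+xp≡yr) = + y , (+ x , (begin
    + y * + r                 ≡⟨ ℤP.pos-* y r ⟨
    + (y ℕ.* r)               ≡⟨ ≡.cong +_ 1+xp≡yr ⟨
    + (1 ℕ.+ x ℕ.* p)         ≡⟨ pos-+* 1 x p ⟩
    1ℤ + + x * + p            ∎))
    where open ≡-Reasoning

  inverse : ∀ a → ¬ (a ≡ 0ℤ ⟨mod + p ⟩) → ∃[ u ] u * a ≡ 1ℤ ⟨mod + p ⟩
  inverse a a≢0 = u , Mod.trans (Mod.*-congˡ u a≡r) u*r≡1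
    where
    r : ℕ
    r = a %ℕ p
    a≡r : a ≡ + r ⟨mod + p ⟩
    a≡r = a /ℕ p , a≡a%ℕn+[a/ℕn]*n a p
    instance
      r-nonZero : ℕ.NonZero r
      r-nonZero = ℕ.≢-nonZero λ r≡0 → a≢0 (≡.subst (λ z → a ≡ + z ⟨mod + p ⟩) r≡0 a≡r)
    residue-inverse : ∃[ u ] u * + r ≡ 1ℤ ⟨mod + p ⟩
    residue-inverse = inverse-of-residue r (coprime-Bézout (prime⇒coprime p-prime (n%ℕd<d a p)))
    u : ℤ
    u = proj₁ residue-inverse
    u*r≡1 : u * + r ≡ 1ℤ ⟨mod + p ⟩
    u*r≡1 = proj₂ residue-inverse

  first-row-nonzero : ∀ {m n} (M : Fin (suc m) → Fin n → ℤ) → HasRankModP p (suc m) n M →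
                      ∃[ ℓ ] ¬ (M zero ℓ ≡ 0ℤ ⟨mod + p ⟩)
  first-row-nonzero {n = n} M independent =
    ¬∀⟶∃¬ n _ (λ ℓ → M zero ℓ ≟ 0ℤ ⟨mod + p ⟩) (1≢0 ∘ [mod]⇒⟨mod⟩ ∘ δ₀≡0)
    where
    δ₀≡0 : (∀ ℓ → M zero ℓ ≡ 0ℤ ⟨mod + p ⟩) → 1ℤ ≡ 0ℤ [mod p ]
    δ₀≡0 row₀≡0 = independent (δ zero) (λ ℓ → ⟨mod⟩⇒[mod] (δ₀M≡0 ℓ)) zero
      where
      δ₀M≡0 : ∀ ℓ → δ zero · (λ i → M i ℓ) ≡ 0ℤ ⟨mod + p ⟩
      δ₀M≡0 ℓ = Mod.trans (Mod.reflexive (δ-· zero (λ i → M i ℓ))) (row₀≡0 ℓ)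

  module Elimination {m n} (M : Fin (suc m) → Fin n → ℤ) (ℓ₀ : Fin n) (u : ℤ)
                     (u-inverse : u * M zero ℓ₀ ≡ 1ℤ ⟨mod + p ⟩) where

    μ : Fin m → ℤ
    μ i = M (suc i) ℓ₀ * u

    M′ : Fin m → Fin n → ℤ
    M′ i ℓ = M (suc i) ℓ - μ i * M zero ℓ

    M′-pivot≡0 : ∀ i → M′ i ℓ₀ ≡ 0ℤ ⟨mod + p ⟩
    M′-pivot≡0 i = begin
      a - μ i * M zero ℓ₀        ≡⟨ lemma a u (M zero ℓ₀) ⟩
      a - a * (u * M zero ℓ₀)    ≈⟨ Mod.+-congˡ a (Mod.-‿cong (Mod.*-congˡ a u-inverse)) ⟩
      a - a * 1ℤ                 ≡⟨ lemma′ a ⟩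
      0ℤ                         ∎
      where
      open ≡-mod-Reasoning (+ p)
      a : ℤ
      a = M (suc i) ℓ₀
      lemma : ∀ a u b → a - a * u * b ≡ a - a * (u * b)
      lemma = solve-∀
      lemma′ : ∀ a → a - a * 1ℤ ≡ 0ℤ
      lemma′ = solve-∀

    row-decomposition : ∀ i v → M (suc i) · v ≡ M′ i · v + μ i * (M zero · v)
    row-decomposition i v = begin
      M (suc i) · v
        ≡⟨ Σ-cong n (λ ℓ → lemma (M (suc i) ℓ) (μ i) (M zero ℓ) (v ℓ)) ⟩
      Σ[ n ] (λ ℓ → M′ i ℓ * v ℓ + μ i * (M zero ℓ * v ℓ))
        ≡⟨ Σ-distrib-+ n _ _ ⟩
      M′ i · v + Σ[ n ] (λ ℓ → μ i * (M zero ℓ * v ℓ))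
        ≡⟨ ≡.cong (_+_ (M′ i · v)) (*-distribˡ-Σ n (μ i) _) ⟨
      M′ i · v + μ i * (M zero · v)  ∎
      where
      open ≡-Reasoning
      lemma : ∀ a c b x → a * x ≡ (a - c * b) * x + c * (b * x)
      lemma = solve-∀

    independent : HasRankModP p (suc m) n M → HasRankModP p m n M′
    independent M-independent κ′ κ′M′≡0 i = M-independent κ κM≡0 (suc i)
      where
      κ : Fin (suc m) → ℤ
      κ zero    = - (κ′ · μ)
      κ (suc i) = κ′ i
      κ′M′≡κM : ∀ ℓ → κ′ · (λ i → M′ i ℓ) ≡ κ · (λ i → M i ℓ)
      κ′M′≡κM ℓ = begin
        κ′ · (λ i → M′ i ℓ)
          ≡⟨ Σ-cong m (λ i → lemma (κ′ i) (M (suc i) ℓ) (μ i) (M zero ℓ)) ⟩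
        Σ[ m ] (λ i → κ′ i * M (suc i) ℓ + κ′ i * μ i * - M zero ℓ)
          ≡⟨ Σ-distrib-+ m _ _ ⟩
        κ′ · (λ i → M (suc i) ℓ) + Σ[ m ] (λ i → κ′ i * μ i * - M zero ℓ)
          ≡⟨ ≡.cong (_+_ (κ′ · (λ i → M (suc i) ℓ))) (*-distribʳ-Σ m (- M zero ℓ) _) ⟨
        κ′ · (λ i → M (suc i) ℓ) + κ′ · μ * - M zero ℓ
          ≡⟨ lemma′ (κ′ · (λ i → M (suc i) ℓ)) (κ′ · μ) (M zero ℓ) ⟩
        - (κ′ · μ) * M zero ℓ + κ′ · (λ i → M (suc i) ℓ)  ∎
        where
        open ≡-Reasoning
        lemma : ∀ k a c b → k * (a - c * b) ≡ k * a + k * c * - b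
        lemma = solve-∀
        lemma′ : ∀ s t b → s + t * - b ≡ - t * b + s
        lemma′ = solve-∀
      κM≡0 : ∀ ℓ → κ · (λ i → M i ℓ) ≡ 0ℤ [mod p ]
      κM≡0 ℓ = ≡.subst (λ z → z ≡ 0ℤ [mod p ]) (κ′M′≡κM ℓ) (κ′M′≡0 ℓ)

  solve : ∀ {m n} (M : Fin m → Fin n → ℤ) → HasRankModP p m n M →
          (d : Fin m → ℤ) → ∃[ β ] (∀ i → M i · β ≡ d i ⟨mod + p ⟩)
  solve {zero}      M _             d = (λ _ → 0ℤ) , λ ()
  solve {suc m} {n} M M-independent d = β , rows
    where
    pivot : ∃[ ℓ ] ¬ (M zero ℓ ≡ 0ℤ ⟨mod + p ⟩)
    pivot = first-row-nonzero M M-independent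
    ℓ₀ : Fin n
    ℓ₀ = proj₁ pivot
    pivot-inverse : ∃[ u ] u * M zero ℓ₀ ≡ 1ℤ ⟨mod + p ⟩
    pivot-inverse = inverse (M zero ℓ₀) (proj₂ pivot)
    u : ℤ
    u = proj₁ pivot-inverse
    open Elimination M ℓ₀ u (proj₂ pivot-inverse)
    reduced : ∃[ β ] (∀ i → M′ i · β ≡ d (suc i) - μ i * d zero ⟨mod + p ⟩)
    reduced = solve M′ (independent M-independent) (λ i → d (suc i) - μ i * d zero)
    β′ : Fin n → ℤ
    β′ = proj₁ reduced

    τ : ℤ
    τ = u * (d zero - M zero · β′)

    β : Fin n → ℤ
    β ℓ = β′ ℓ + δ ℓ₀ ℓ * τ

    ·-β : ∀ v → v · β ≡ v · β′ + v ℓ₀ * τ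
    ·-β v = begin
      v · β                                           ≡⟨ Σ-cong n (λ ℓ → ℤP.*-distribˡ-+ (v ℓ) _ _) ⟩
      Σ[ n ] (λ ℓ → v ℓ * β′ ℓ + v ℓ * (δ ℓ₀ ℓ * τ))  ≡⟨ Σ-distrib-+ n _ _ ⟩
      v · β′ + Σ[ n ] (λ ℓ → v ℓ * (δ ℓ₀ ℓ * τ))      ≡⟨ ≡.cong (_+_ (v · β′)) δ-term ⟩
      v · β′ + v ℓ₀ * τ                               ∎
      where
      open ≡-Reasoning
      δ-term : Σ[ n ] (λ ℓ → v ℓ * (δ ℓ₀ ℓ * τ)) ≡ v ℓ₀ * τ
      δ-term = begin
        Σ[ n ] (λ ℓ → v ℓ * (δ ℓ₀ ℓ * τ))  ≡⟨ Σ-cong n (λ ℓ → ℤP.*-assoc (v ℓ) (δ ℓ₀ ℓ) τ) ⟨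
        Σ[ n ] (λ ℓ → v ℓ * δ ℓ₀ ℓ * τ)    ≡⟨ *-distribʳ-Σ n τ _ ⟨
        v · δ ℓ₀ * τ                       ≡⟨ ≡.cong (_* τ) (·-δ v ℓ₀) ⟩
        v ℓ₀ * τ                           ∎

    row₀ : M zero · β ≡ d zero ⟨mod + p ⟩
    row₀ = begin
      M zero · β                                   ≡⟨ ·-β (M zero) ⟩
      M zero · β′ + M zero ℓ₀ * τ                  ≡⟨ lemma (M zero · β′) (M zero ℓ₀) u (d zero) ⟩
      M zero · β′ + u * M zero ℓ₀ * (d zero - M zero · β′)
        ≈⟨ Mod.+-congˡ (M zero · β′) (Mod.*-congʳ _ (proj₂ pivot-inverse)) ⟩
      M zero · β′ + 1ℤ * (d zero - M zero · β′)    ≡⟨ lemma′ (M zero · β′) (d zero) ⟩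
      d zero                                       ∎
      where
      open ≡-mod-Reasoning (+ p)
      lemma : ∀ s a u d → s + a * (u * (d - s)) ≡ s + u * a * (d - s)
      lemma = solve-∀
      lemma′ : ∀ s d → s + 1ℤ * (d - s) ≡ d
      lemma′ = solve-∀

    rows : ∀ i → M i · β ≡ d i ⟨mod + p ⟩
    rows zero    = row₀
    rows (suc i) = begin
      M (suc i) · β
        ≡⟨ row-decomposition i β ⟩
      M′ i · β + μ i * (M zero · β)
        ≡⟨ ≡.cong (_+ μ i * (M zero · β)) (·-β (M′ i)) ⟩
      M′ i · β′ + M′ i ℓ₀ * τ + μ i * (M zero · β)
        ≈⟨ Mod.+-cong (Mod.+-cong (proj₂ reduced i) (Mod.*-congʳ τ (M′-pivot≡0 i)))
                      (Mod.*-congˡ (μ i) row₀) ⟩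
      d (suc i) - μ i * d zero + 0ℤ * τ + μ i * d zero
        ≡⟨ lemma (d (suc i)) (μ i) (d zero) τ ⟩
      d (suc i)  ∎
      where
      open ≡-mod-Reasoning (+ p)
      lemma : ∀ d c d₀ t → d - c * d₀ + 0ℤ * t + c * d₀ ≡ d
      lemma = solve-∀

-- Euler's totient of a prime power

module TotientOfPrimePower (p : ℕ) (p-prime : Prime p) where

  private
    instance
      p-nonZero : ℕ.NonZero p
      p-nonZero = prime⇒nonZero p-prime
      p-nonTrivial : ℕ.NonTrivial p
      p-nonTrivial = prime⇒nonTrivial p-prime

  ∤? : Decidable (λ i → ¬ p ℕ.∣ i)
  ∤? i = ¬? (p ℕD.∣? i)

  nonMultiples : ℕ → ℕ
  nonMultiples n = length (filter ∤? (map suc (upTo n)))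

  nonMultiples-suc : ∀ n → nonMultiples (suc n) ≡ nonMultiples n ℕ.+ length (filter ∤? [ suc n ])
  nonMultiples-suc n = begin
    length (filter ∤? (map suc (upTo (suc n))))
      ≡⟨ ≡.cong (length ∘ filter ∤? ∘ map suc) (upTo-∷ʳ n) ⟨
    length (filter ∤? (map suc (upTo n ++ [ n ])))
      ≡⟨ ≡.cong (length ∘ filter ∤?) (map-++ suc (upTo n) [ n ]) ⟩
    length (filter ∤? (map suc (upTo n) ++ [ suc n ]))
      ≡⟨ ≡.cong length (filter-++ ∤? (map suc (upTo n)) [ suc n ]) ⟩
    length (filter ∤? (map suc (upTo n)) ++ filter ∤? [ suc n ])
      ≡⟨ length-++ (filter ∤? (map suc (upTo n))) ⟩
    nonMultiples n ℕ.+ length (filter ∤? [ suc n ])  ∎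
    where open ≡-Reasoning

  nonMultiples-suc-∤ : ∀ n → ¬ p ℕ.∣ suc n → nonMultiples (suc n) ≡ nonMultiples n ℕ.+ 1
  nonMultiples-suc-∤ n p∤1+n = ≡.trans (nonMultiples-suc n)
    (≡.cong (λ l → nonMultiples n ℕ.+ length l) (filter-accept ∤? p∤1+n))

  nonMultiples-suc-∣ : ∀ n → p ℕ.∣ suc n → nonMultiples (suc n) ≡ nonMultiples n
  nonMultiples-suc-∣ n p∣1+n = ≡.trans (nonMultiples-suc n)
    (≡.trans (≡.cong (λ l → nonMultiples n ℕ.+ length l) (filter-reject ∤? (λ p∤1+n → p∤1+n p∣1+n)))
       (ℕP.+-identityʳ (nonMultiples n)))

  nonMultiples-block : ∀ q r → r ℕ.< p →
                       nonMultiples (q ℕ.* p ℕ.+ r) ≡ nonMultiples (q ℕ.* p) ℕ.+ r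
  nonMultiples-block q zero    _     =
    ≡.trans (≡.cong nonMultiples (ℕP.+-identityʳ (q ℕ.* p))) (≡.sym (ℕP.+-identityʳ _))
  nonMultiples-block q (suc r) 1+r<p = begin
    nonMultiples (qp ℕ.+ suc r)    ≡⟨ ≡.cong nonMultiples (ℕP.+-suc qp r) ⟩
    nonMultiples (suc (qp ℕ.+ r))  ≡⟨ nonMultiples-suc-∤ (qp ℕ.+ r) p∤1+qp+r ⟩
    nonMultiples (qp ℕ.+ r) ℕ.+ 1  ≡⟨ ≡.cong (ℕ._+ 1) (nonMultiples-block q r r<p) ⟩
    nonMultiples qp ℕ.+ r ℕ.+ 1    ≡⟨ lemma (nonMultiples qp) r ⟩
    nonMultiples qp ℕ.+ suc r      ∎
    where
    open ≡-Reasoning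
    qp : ℕ
    qp = q ℕ.* p
    r<p : r ℕ.< p
    r<p = ℕP.<-trans (ℕP.n<1+n r) 1+r<p
    lemma : ∀ a r → a ℕ.+ r ℕ.+ 1 ≡ a ℕ.+ suc r
    lemma = ℕ-Solver.solve-∀
    p∤1+qp+r : ¬ p ℕ.∣ suc (qp ℕ.+ r)
    p∤1+qp+r p∣1+qp+r = ℕP.<⇒≱ 1+r<p (ℕD.∣⇒≤ (ℕD.∣m+n∣m⇒∣n p∣qp+1+r (ℕD.n∣m*n q)))
      where
      p∣qp+1+r : p ℕ.∣ qp ℕ.+ suc r
      p∣qp+1+r = ≡.subst (p ℕ.∣_) (≡.sym (ℕP.+-suc qp r)) p∣1+qp+r

  nonMultiples-multiple : ∀ q → nonMultiples (q ℕ.* p) ≡ q ℕ.* (p ℕ.∸ 1)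
  nonMultiples-multiple zero    = ≡.refl
  nonMultiples-multiple (suc q) = begin
    nonMultiples (suc q ℕ.* p)                  ≡⟨ ≡.cong nonMultiples [1+q]p≡1+qp+[p-1] ⟩
    nonMultiples (suc (q ℕ.* p ℕ.+ (p ℕ.∸ 1)))  ≡⟨ nonMultiples-suc-∣ _ p∣[1+q]p ⟩
    nonMultiples (q ℕ.* p ℕ.+ (p ℕ.∸ 1))        ≡⟨ nonMultiples-block q (p ℕ.∸ 1) p-1<p ⟩
    nonMultiples (q ℕ.* p) ℕ.+ (p ℕ.∸ 1)        ≡⟨ ≡.cong (ℕ._+ (p ℕ.∸ 1)) (nonMultiples-multiple q) ⟩
    q ℕ.* (p ℕ.∸ 1) ℕ.+ (p ℕ.∸ 1)               ≡⟨ ℕP.+-comm (q ℕ.* (p ℕ.∸ 1)) (p ℕ.∸ 1) ⟩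
    suc q ℕ.* (p ℕ.∸ 1)                         ∎
    where
    open ≡-Reasoning
    p-1<p : p ℕ.∸ 1 ℕ.< p
    p-1<p = ≡.subst (p ℕ.∸ 1 ℕ.<_) (ℕP.suc-pred p) (ℕP.n<1+n (p ℕ.∸ 1))
    [1+q]p≡1+qp+[p-1] : suc q ℕ.* p ≡ suc (q ℕ.* p ℕ.+ (p ℕ.∸ 1))
    [1+q]p≡1+qp+[p-1] = begin
      p ℕ.+ q ℕ.* p               ≡⟨ ℕP.+-comm p (q ℕ.* p) ⟩
      q ℕ.* p ℕ.+ p               ≡⟨ ≡.cong (q ℕ.* p ℕ.+_) (ℕP.suc-pred p) ⟨
      q ℕ.* p ℕ.+ suc (p ℕ.∸ 1)   ≡⟨ ℕP.+-suc (q ℕ.* p) (p ℕ.∸ 1) ⟩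
      suc (q ℕ.* p ℕ.+ (p ℕ.∸ 1)) ∎
    p∣[1+q]p : p ℕ.∣ suc (q ℕ.* p ℕ.+ (p ℕ.∸ 1))
    p∣[1+q]p = ≡.subst (p ℕ.∣_) [1+q]p≡1+qp+[p-1] (ℕD.n∣m*n (suc q))

  ∤⇒coprime : ∀ {i} → ¬ p ℕ.∣ i → Coprime p i
  ∤⇒coprime p∤i {d} (d∣p , d∣i) with prime⇒irreducible p-prime d∣p
  ... | inj₁ d≡1  = d≡1
  ... | inj₂ ≡.refl = contradiction d∣i p∤i

  ∤⇒coprime-^ : ∀ {i} → ¬ p ℕ.∣ i → ∀ k → Coprime i (p ℕ.^ k)
  ∤⇒coprime-^ p∤i zero        (_ , d∣1)         = ℕD.∣1⇒≡1 d∣1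
  ∤⇒coprime-^ p∤i (suc k) {d} (d∣i , d∣p^[1+k]) =
    ∤⇒coprime-^ p∤i k (d∣i , coprime-divisor coprime[d,p] d∣p^[1+k])
    where
    coprime[d,p] : Coprime d p
    coprime[d,p] (c∣d , c∣p) = ∤⇒coprime p∤i (c∣p , ℕD.∣-trans c∣d d∣i)

  coprime-^⇔∤ : ∀ k → (λ i → Coprime i (p ℕ.^ suc k)) ≐ (λ i → ¬ p ℕ.∣ i)
  coprime-^⇔∤ k =
    (λ coprime p∣i → ℕ.nonTrivial⇒≢1 (coprime (p∣i , ℕD.m∣m*n (p ℕ.^ k)))) ,
    (λ p∤i → ∤⇒coprime-^ p∤i (suc k))

  φ-prime-power : ∀ k → φ (p ℕ.^ suc k) ≡ p ℕ.^ k ℕ.* (p ℕ.∸ 1)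
  φ-prime-power k = begin
    φ (p ℕ.^ suc k)
      ≡⟨ ≡.cong length (filter-≐ _ ∤? (coprime-^⇔∤ k) (map suc (upTo (p ℕ.^ suc k)))) ⟩
    nonMultiples (p ℕ.* p ℕ.^ k) ≡⟨ ≡.cong nonMultiples (ℕP.*-comm p (p ℕ.^ k)) ⟩
    nonMultiples (p ℕ.^ k ℕ.* p) ≡⟨ nonMultiples-multiple (p ℕ.^ k) ⟩
    p ℕ.^ k ℕ.* (p ℕ.∸ 1)        ∎
    where open ≡-Reasoning

-- Binomial estimates and powers of an odd prime

[1+n]C2≡nC2+n : ∀ n → suc n C 2 ≡ n C 2 ℕ.+ n
[1+n]C2≡nC2+n n = begin
  suc n C 2          ≡⟨ nCk+nC[k+1]≡[n+1]C[k+1] n 1 ⟨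
  n C 1 ℕ.+ n C 2    ≡⟨ ≡.cong (ℕ._+ n C 2) (nC1≡n n) ⟩
  n ℕ.+ n C 2        ≡⟨ ℕP.+-comm n (n C 2) ⟩
  n C 2 ℕ.+ n        ∎
  where open ≡-Reasoning

[1+2q]C2≡[1+2q]q : ∀ q → suc (q ℕ.* 2) C 2 ≡ suc (q ℕ.* 2) ℕ.* q
[1+2q]C2≡[1+2q]q zero    = ≡.refl
[1+2q]C2≡[1+2q]q (suc q) = begin
  suc (suc (suc (q ℕ.* 2))) C 2
    ≡⟨ [1+n]C2≡nC2+n (suc (suc (q ℕ.* 2))) ⟩
  suc (suc (q ℕ.* 2)) C 2 ℕ.+ suc (suc (q ℕ.* 2))
    ≡⟨ ≡.cong (ℕ._+ suc (suc (q ℕ.* 2))) ([1+n]C2≡nC2+n (suc (q ℕ.* 2))) ⟩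
  suc (q ℕ.* 2) C 2 ℕ.+ suc (q ℕ.* 2) ℕ.+ suc (suc (q ℕ.* 2))
    ≡⟨ ≡.cong (λ c → c ℕ.+ suc (q ℕ.* 2) ℕ.+ suc (suc (q ℕ.* 2))) ([1+2q]C2≡[1+2q]q q) ⟩
  suc (q ℕ.* 2) ℕ.* q ℕ.+ suc (q ℕ.* 2) ℕ.+ suc (suc (q ℕ.* 2))
    ≡⟨ lemma q ⟩
  suc (suc q ℕ.* 2) ℕ.* suc q  ∎
  where
  open ≡-Reasoning
  lemma : ∀ q → suc (q ℕ.* 2) ℕ.* q ℕ.+ suc (q ℕ.* 2) ℕ.+ suc (suc (q ℕ.* 2)) ≡
                suc (suc q ℕ.* 2) ℕ.* suc q
  lemma = ℕ-Solver.solve-∀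

odd⇒≡1+q*2 : ∀ n → ¬ 2 ℕ.∣ n → ∃[ q ] n ≡ suc (q ℕ.* 2)
odd⇒≡1+q*2 zero          2∤0   = contradiction (ℕD.divides 0 ≡.refl) 2∤0
odd⇒≡1+q*2 (suc zero)    _     = 0 , ≡.refl
odd⇒≡1+q*2 (suc (suc n)) 2∤2+n
  with odd⇒≡1+q*2 n (2∤2+n ∘ ℕD.∣m∣n⇒∣m+n (ℕD.∣-refl {2}))
... | q , ≡.refl = suc q , ≡.refl

odd⇒∣C2 : ∀ n → ¬ 2 ℕ.∣ n → n ℕ.∣ n C 2
odd⇒∣C2 n 2∤n with odd⇒≡1+q*2 n 2∤n
... | q , ≡.refl = ℕD.divides q (≡.trans ([1+2q]C2≡[1+2q]q q) (ℕP.*-comm (suc (q ℕ.* 2)) q))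

binomial-mod-cube : ∀ z n → (1ℤ + z) ^ n ≡ 1ℤ + + n * z + + (n C 2) * (z * z) ⟨mod z * z * z ⟩
binomial-mod-cube z zero    = Mod.reflexive (lemma z)
  where
  lemma : ∀ z → 1ℤ ≡ 1ℤ + 0ℤ * z + 0ℤ * (z * z)
  lemma = solve-∀
binomial-mod-cube z (suc n) = begin
  (1ℤ + z) * (1ℤ + z) ^ n                         ≈⟨ Mod.*-congˡ (1ℤ + z) (binomial-mod-cube z n) ⟩
  (1ℤ + z) * (1ℤ + + n * z + + (n C 2) * (z * z)) ≡⟨ lemma z (+ n) (+ (n C 2)) ⟩
  1ℤ + (1ℤ + + n) * z + (+ (n C 2) + + n) * (z * z) + + (n C 2) * (z * z * z)
    ≈⟨ Mod.multiple _ (+ (n C 2)) ⟩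
  1ℤ + + suc n * z + + (n C 2 ℕ.+ n) * (z * z)
    ≡⟨ ≡.cong (λ c → 1ℤ + + suc n * z + + c * (z * z)) ([1+n]C2≡nC2+n n) ⟨
  1ℤ + + suc n * z + + (suc n C 2) * (z * z)      ∎
  where
  open ≡-mod-Reasoning (z * z * z)
  lemma : ∀ z n c → (1ℤ + z) * (1ℤ + n * z + c * (z * z)) ≡
          1ℤ + (1ℤ + n) * z + (c + n) * (z * z) + c * (z * z * z)
  lemma = solve-∀

binomial-mod-square : ∀ u e γ → (1ℤ + u * e) ^ γ ≡ 1ℤ + u * (+ γ * e) ⟨mod u * u ⟩
binomial-mod-square u e zero    = Mod.reflexive (lemma u e)
  where
  lemma : ∀ u e → 1ℤ ≡ 1ℤ + u * (0ℤ * e)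
  lemma = solve-∀
binomial-mod-square u e (suc γ) = begin
  (1ℤ + u * e) * (1ℤ + u * e) ^ γ
    ≈⟨ Mod.*-congˡ (1ℤ + u * e) (binomial-mod-square u e γ) ⟩
  (1ℤ + u * e) * (1ℤ + u * (+ γ * e))               ≡⟨ lemma u e (+ γ) ⟩
  1ℤ + u * ((1ℤ + + γ) * e) + + γ * e * e * (u * u) ≈⟨ Mod.multiple _ (+ γ * e * e) ⟩
  1ℤ + u * (+ suc γ * e)                             ∎
  where
  open ≡-mod-Reasoning (u * u)
  lemma : ∀ u e g → (1ℤ + u * e) * (1ℤ + u * (g * e)) ≡
                    1ℤ + u * ((1ℤ + g) * e) + g * e * e * (u * u)
  lemma = solve-∀

Π-linear-mod-square : ∀ u n (a b : Fin n → ℤ) →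
  Π[ n ] (λ ℓ → a ℓ * (1ℤ + u * b ℓ)) ≡ Π[ n ] a * (1ℤ + u * Σ[ n ] b) ⟨mod u * u ⟩
Π-linear-mod-square u zero    a b = Mod.reflexive (lemma u)
  where
  lemma : ∀ u → 1ℤ ≡ 1ℤ * (1ℤ + u * 0ℤ)
  lemma = solve-∀
Π-linear-mod-square u (suc n) a b = begin
  a zero * (1ℤ + u * b zero) * Π[ n ] (λ ℓ → a (suc ℓ) * (1ℤ + u * b (suc ℓ)))
    ≈⟨ Mod.*-congˡ (a zero * (1ℤ + u * b zero)) (Π-linear-mod-square u n (a ∘ suc) (b ∘ suc)) ⟩
  a zero * (1ℤ + u * b zero) * (A * (1ℤ + u * B))
    ≡⟨ lemma u (a zero) (b zero) A B ⟩
  a zero * A * (1ℤ + u * (b zero + B)) + a zero * A * b zero * B * (u * u)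
    ≈⟨ Mod.multiple _ (a zero * A * b zero * B) ⟩
  a zero * A * (1ℤ + u * (b zero + B))  ∎
  where
  open ≡-mod-Reasoning (u * u)
  A B : ℤ
  A = Π[ n ] (a ∘ suc)
  B = Σ[ n ] (b ∘ suc)
  lemma : ∀ u a₀ b₀ A B → a₀ * (1ℤ + u * b₀) * (A * (1ℤ + u * B)) ≡
          a₀ * A * (1ℤ + u * (b₀ + B)) + a₀ * A * b₀ * B * (u * u)
  lemma = solve-∀

x^[2+k]∣x^[1+k]² : ∀ x k → x ^ suc (suc k) ℤS.∣ x ^ suc k * x ^ suc k
x^[2+k]∣x^[1+k]² x k = divides (x ^ k) (lemma x (x ^ k))
  where
  lemma : ∀ x y → x * y * (x * y) ≡ y * (x * (x * y))
  lemma = solve-∀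

module OddPrimePowers (p : ℕ) (p-odd : ¬ 2 ℕ.∣ p) where

  pℤ : ℤ
  pℤ = + p

  pow-p-lift : ∀ s w y → y ≡ 1ℤ + pℤ ^ suc s * w ⟨mod pℤ ^ suc (suc s) ⟩ →
               y ^ p ≡ 1ℤ + pℤ ^ suc (suc s) * w ⟨mod pℤ ^ suc (suc (suc s)) ⟩
  pow-p-lift s w _ (v , ≡.refl) = begin
    (1ℤ + pℤ * ps * w + v * (pℤ * (pℤ * ps))) ^ p
      ≡⟨ ≡.cong (_^ p) (ℤP.+-assoc 1ℤ (pℤ * ps * w) (v * (pℤ * (pℤ * ps)))) ⟩
    (1ℤ + z) ^ p                          ≈⟨ Mod.weaken p^[3+s]∣z³ (binomial-mod-cube z p) ⟩
    1ℤ + pℤ * z + + (p C 2) * (z * z)     ≡⟨ ≡.cong (λ c → 1ℤ + pℤ * z + c * (z * z)) pC2≡qp ⟩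
    1ℤ + pℤ * z + q * pℤ * (z * z)        ≡⟨ lemma pℤ ps w v q ⟩
    1ℤ + pℤ * (pℤ * ps) * w + (v + q * ps * W * W) * (pℤ * (pℤ * (pℤ * ps)))
      ≈⟨ Mod.multiple _ (v + q * ps * W * W) ⟩
    1ℤ + pℤ * (pℤ * ps) * w               ∎
    where
    open ≡-mod-Reasoning (pℤ ^ suc (suc (suc s)))
    p∣pC2 : p ℕ.∣ p C 2
    p∣pC2 = odd⇒∣C2 p p-odd
    ps W z q : ℤ
    ps = pℤ ^ s
    W = w + v * pℤ
    z = pℤ * ps * w + v * (pℤ * (pℤ * ps))
    q = + ℕD._∣_.quotient p∣pC2
    pC2≡qp : + (p C 2) ≡ q * pℤ
    pC2≡qp = ≡.trans (≡.cong +_ (ℕD._∣_.equality p∣pC2))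
                     (ℤP.pos-* (ℕD._∣_.quotient p∣pC2) p)
    p^[3+s]∣z³ : pℤ * (pℤ * (pℤ * ps)) ℤS.∣ z * z * z
    p^[3+s]∣z³ = divides (ps * ps * W * W * W) (cube pℤ ps w v)
      where
      cube : ∀ p s w v →
        (p * s * w + v * (p * (p * s))) * (p * s * w + v * (p * (p * s))) * (p * s * w + v * (p * (p * s)))
        ≡ s * s * (w + v * p) * (w + v * p) * (w + v * p) * (p * (p * (p * s)))
      cube = solve-∀
    lemma : ∀ p s w v q →
      1ℤ + p * (p * s * w + v * (p * (p * s)))
         + q * p * ((p * s * w + v * (p * (p * s))) * (p * s * w + v * (p * (p * s))))
      ≡ 1ℤ + p * (p * s) * w + (v + q * s * (w + v * p) * (w + v * p)) * (p * (p * (p * s)))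
    lemma = solve-∀

  pow-p^k[p-1] : ∀ {x e} → x ^ (p ℕ.∸ 1) ≡ 1ℤ + pℤ * e ⟨mod pℤ ^ 2 ⟩ →
                 ∀ k → x ^ (p ℕ.^ k ℕ.* (p ℕ.∸ 1)) ≡ 1ℤ + pℤ ^ suc k * e
                       ⟨mod pℤ ^ suc (suc k) ⟩
  pow-p^k[p-1] {x} {e} x^[p-1]≡1+pe zero    =
    ≡.subst (λ n → x ^ n ≡ 1ℤ + pℤ ^ 1 * e ⟨mod pℤ ^ 2 ⟩) (≡.sym (ℕP.*-identityˡ (p ℕ.∸ 1)))
      (Mod.trans x^[p-1]≡1+pe (Mod.reflexive (≡.cong (λ q → 1ℤ + q * e) p≡p^1)))
    where
    p≡p^1 : pℤ ≡ pℤ ^ 1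
    p≡p^1 = ≡.sym (ℤP.^-identityʳ pℤ)
  pow-p^k[p-1] {x} x^[p-1]≡1+pe (suc k) = begin
    x ^ (p ℕ.^ suc k ℕ.* (p ℕ.∸ 1))        ≡⟨ ≡.cong (x ^_) (lemma (p ℕ.^ k) p (p ℕ.∸ 1)) ⟩
    x ^ (p ℕ.^ k ℕ.* (p ℕ.∸ 1) ℕ.* p)      ≡⟨ ℤP.^-*-assoc x (p ℕ.^ k ℕ.* (p ℕ.∸ 1)) p ⟨
    (x ^ (p ℕ.^ k ℕ.* (p ℕ.∸ 1))) ^ p      ≈⟨ pow-p-lift k _ _ (pow-p^k[p-1] x^[p-1]≡1+pe k) ⟩
    1ℤ + pℤ ^ suc (suc k) * _              ∎
    where
    open ≡-mod-Reasoning (pℤ ^ suc (suc (suc k)))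
    lemma : ∀ a p b → p ℕ.* a ℕ.* b ≡ a ℕ.* b ℕ.* p
    lemma = ℕ-Solver.solve-∀

  pow-+-p^k[p-1] : ∀ {x e} → x ^ (p ℕ.∸ 1) ≡ 1ℤ + pℤ * e ⟨mod pℤ ^ 2 ⟩ → ∀ k β γ →
    x ^ (β ℕ.+ p ℕ.^ k ℕ.* (p ℕ.∸ 1) ℕ.* γ) ≡ x ^ β * (1ℤ + pℤ ^ suc k * (+ γ * e))
    ⟨mod pℤ ^ suc (suc k) ⟩
  pow-+-p^k[p-1] {x} {e} x^[p-1]≡1+pe k β γ = begin
    x ^ (β ℕ.+ d ℕ.* γ)                     ≡⟨ ℤP.^-distribˡ-+-* x β (d ℕ.* γ) ⟩
    x ^ β * x ^ (d ℕ.* γ)                   ≡⟨ ≡.cong (_*_ (x ^ β)) (ℤP.^-*-assoc x d γ) ⟨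
    x ^ β * (x ^ d) ^ γ
      ≈⟨ Mod.*-congˡ (x ^ β) (Mod.^-cong γ (pow-p^k[p-1] x^[p-1]≡1+pe k)) ⟩
    x ^ β * (1ℤ + pℤ ^ suc k * e) ^ γ
      ≈⟨ Mod.*-congˡ (x ^ β) (Mod.weaken (x^[2+k]∣x^[1+k]² pℤ k)
                                         (binomial-mod-square (pℤ ^ suc k) e γ)) ⟩
    x ^ β * (1ℤ + pℤ ^ suc k * (+ γ * e))   ∎
    where
    open ≡-mod-Reasoning (pℤ ^ suc (suc k))
    d : ℕ
    d = p ℕ.^ k ℕ.* (p ℕ.∸ 1)

-- Exponents modulo the order of a unit

pos-≡-mod⇒ : ∀ {u v d} → + u ≡ + v ⟨mod + d ⟩ →
             ∃[ r ] u ≡ v ℕ.+ r ℕ.* d ⊎ ∃[ r ] v ≡ u ℕ.+ r ℕ.* d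
pos-≡-mod⇒ {u} {v} {d} (+ r , u≡v+rd) =
  inj₁ (r , ℤP.+-injective (≡.trans u≡v+rd (≡.sym (pos-+* v r d))))
pos-≡-mod⇒ {u} {v} {d} (-[1+ r ] , u≡v-[1+r]d) = inj₂ (suc r , ℤP.+-injective (begin
  + v                                    ≡⟨ lemma (+ v) (+ suc r) (+ d) ⟩
  + v + - + suc r * + d + + suc r * + d  ≡⟨ ≡.cong (_+ + suc r * + d) u≡v-[1+r]d ⟨
  + u + + suc r * + d                    ≡⟨ pos-+* u (suc r) d ⟨
  + (u ℕ.+ suc r ℕ.* d)                  ∎))
  where
  open ≡-Reasoning
  lemma : ∀ v s d → v ≡ v + - s * d + s * d
  lemma = solve-∀

pow-+-multiple : ∀ {N x d} → x ^ d ≡ 1ℤ ⟨mod N ⟩ →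
                 ∀ v r → x ^ (v ℕ.+ r ℕ.* d) ≡ x ^ v ⟨mod N ⟩
pow-+-multiple {N} {x} {d} x^d≡1 v r = begin
  x ^ (v ℕ.+ r ℕ.* d)     ≡⟨ ℤP.^-distribˡ-+-* x v (r ℕ.* d) ⟩
  x ^ v * x ^ (r ℕ.* d)   ≡⟨ ≡.cong (λ n → x ^ v * x ^ n) (ℕP.*-comm r d) ⟩
  x ^ v * x ^ (d ℕ.* r)   ≡⟨ ≡.cong (_*_ (x ^ v)) (ℤP.^-*-assoc x d r) ⟨
  x ^ v * (x ^ d) ^ r     ≈⟨ Mod.*-congˡ (x ^ v) (Mod.^-cong r x^d≡1) ⟩
  x ^ v * 1ℤ ^ r          ≡⟨ ≡.cong (_*_ (x ^ v)) (ℤP.^-zeroˡ r) ⟩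
  x ^ v * 1ℤ              ≡⟨ ℤP.*-identityʳ (x ^ v) ⟩
  x ^ v                   ∎
  where open ≡-mod-Reasoning N

pow-cong-exponent : ∀ {N x d u v} → x ^ d ≡ 1ℤ ⟨mod N ⟩ → + u ≡ + v ⟨mod + d ⟩ →
                    x ^ u ≡ x ^ v ⟨mod N ⟩
pow-cong-exponent {u = u} {v} x^d≡1 u≡v with pos-≡-mod⇒ u≡v
... | inj₁ (r , ≡.refl) = pow-+-multiple x^d≡1 v r
... | inj₂ (r , ≡.refl) = Mod.sym (pow-+-multiple x^d≡1 u r)

pow≡PowMod : ∀ {M x d α c β} → x ^ d ≡ 1ℤ ⟨mod + M ⟩ → PowMod M x α c →
             + β ≡ α ⟨mod + d ⟩ → x ^ β ≡ c ⟨mod + M ⟩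
pow≡PowMod {α = + a} x^d≡1 c≡x^a β≡a =
  Mod.trans (pow-cong-exponent x^d≡1 β≡a) (Mod.sym ([mod]⇒⟨mod⟩ c≡x^a))
pow≡PowMod {M} {x} {d} {α = -[1+ a ]} {c} {β} x^d≡1 cx^[1+a]≡1 (q , β≡-[1+a]+qd) = begin
  x ^ β                         ≡⟨ ℤP.*-identityʳ (x ^ β) ⟨
  x ^ β * 1ℤ                    ≈⟨ Mod.*-congˡ (x ^ β) (Mod.sym ([mod]⇒⟨mod⟩ cx^[1+a]≡1)) ⟩
  x ^ β * (c * x ^ suc a)       ≡⟨ lemma (x ^ β) c (x ^ suc a) ⟩
  c * (x ^ β * x ^ suc a)       ≡⟨ ≡.cong (_*_ c) (ℤP.^-distribˡ-+-* x β (suc a)) ⟨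
  c * x ^ (β ℕ.+ suc a)         ≈⟨ Mod.*-congˡ c (pow-cong-exponent x^d≡1 β+1+a≡0) ⟩
  c * 1ℤ                        ≡⟨ ℤP.*-identityʳ c ⟩
  c                             ∎
  where
  open ≡-mod-Reasoning (+ M)
  lemma : ∀ y c z → y * (c * z) ≡ c * (y * z)
  lemma = solve-∀
  cancel : ∀ s q d → - s + q * d + s ≡ 0ℤ + q * d
  cancel = solve-∀
  β+1+a≡0 : + (β ℕ.+ suc a) ≡ + 0 ⟨mod + d ⟩
  β+1+a≡0 = q , ≡.trans (ℤP.pos-+ β (suc a))
                 (≡.trans (≡.cong (_+ + suc a) β≡-[1+a]+qd) (cancel (+ suc a) q (+ d)))

-- Coordinates of p-adic integers

^-∣-≤′ : ∀ x {k l} → k ℕ.≤′ l → x ^ k ℤS.∣ x ^ l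
^-∣-≤′ x ℕ.≤′-refl        = ℤS.∣-refl
^-∣-≤′ x (ℕ.≤′-step k≤′l) = ℤS.∣n⇒∣m*n x (^-∣-≤′ x k≤′l)

seq-≡-mod : ∀ {p} (s : ℤp p) {k l} → k ℕ.≤′ l → seq s l ≡ seq s k ⟨mod (+ p) ^ suc k ⟩
seq-≡-mod s ℕ.≤′-refl = Mod.refl
seq-≡-mod {p} s (ℕ.≤′-step {l} k≤′l) =
  Mod.trans (Mod.weaken (^-∣-≤′ (+ p) (ℕP.s≤′s k≤′l))
                        (Mod.modulus-cong (pos-^ p (suc l)) ([mod]⇒⟨mod⟩ (coh s l))))
            (seq-≡-mod s k≤′l)

-- Hensel lifting

module HenselLifting
  (p : ℕ) (p-prime : Prime p) (p-odd : ¬ 2 ℕ.∣ p) (m n : ℕ) (t : Fin m → ℕ)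
  (a : (i : Fin m) → Fin (t i) → ℤp p) (x : (i : Fin m) → Fin (t i) → Fin n → ℤpˣ p)
  (y : Fin m → ℤp p) (α₁ : Fin n → ℤ) (c₀ : (i : Fin m) → Fin (t i) → Fin n → ℤ)
  (c₀-powMod : ∀ i j ℓ → PowMod p (seq (elt (x i j ℓ)) 0) (α₁ ℓ) (c₀ i j ℓ))
  (e : (i : Fin m) → Fin (t i) → Fin n → ℤ)
  (e-E2 : ∀ i j ℓ → E2 p (seq (elt (x i j ℓ)) 1) (e i j ℓ))
  (g≡y-mod-p : ∀ i → Σ[ t i ] (λ j → seq (a i j) 0 * Π[ n ] (λ ℓ → c₀ i j ℓ))
                     ≡ seq (y i) 0 [mod p ])
  (J-rank : HasRankModP p m n
     (λ i ℓ → Σ[ t i ] (λ j → seq (a i j) 0 * e i j ℓ * Π[ n ] (λ ℓ′ → c₀ i j ℓ′))))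
  where

  open OddPrimePowers p p-odd
  open LinearAlgebraModPrime p p-prime using (solve)
  open TotientOfPrimePower p p-prime using (φ-prime-power)

  private
    instance
      p-nonZero : ℕ.NonZero p
      p-nonZero = prime⇒nonZero p-prime
      p-nonTrivial : ℕ.NonTrivial p
      p-nonTrivial = prime⇒nonTrivial p-prime
      p-1-nonZero : ℕ.NonZero (p ℕ.∸ 1)
      p-1-nonZero = ℕ.>-nonZero (ℕP.m<n⇒0<n∸m (ℕ.nonTrivial⇒n>1 p))

  X : (i : Fin m) → Fin (t i) → Fin n → ℕ → ℤ
  X i j ℓ = seq (elt (x i j ℓ))

  A : (i : Fin m) → Fin (t i) → ℕ → ℤ
  A i j = seq (a i j)

  Y : Fin m → ℕ → ℤ
  Y i = seq (y i)

  g : Fin m → ℕ → (Fin n → ℕ) → ℤ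
  g i k β = Σ[ t i ] (λ j → A i j k * Π[ n ] (λ ℓ → X i j ℓ k ^ β ℓ))

  J : Fin m → Fin n → ℤ
  J i ℓ = Σ[ t i ] (λ j → A i j 0 * e i j ℓ * Π[ n ] (c₀ i j))

  ≡-mod-p : ∀ (s : ℤp p) k → seq s k ≡ seq s 0 ⟨mod pℤ ⟩
  ≡-mod-p s k = Mod.modulus-cong (ℤP.^-identityʳ pℤ) (seq-≡-mod s ℕP.z≤′n)

  x^[p-1]≡1+pe : ∀ i j ℓ k →
                 X i j ℓ (suc k) ^ (p ℕ.∸ 1) ≡ 1ℤ + pℤ * e i j ℓ ⟨mod pℤ ^ 2 ⟩
  x^[p-1]≡1+pe i j ℓ k =
    Mod.trans (Mod.^-cong (p ℕ.∸ 1) (seq-≡-mod (elt (x i j ℓ)) (ℕP.s≤′s ℕP.z≤′n)))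
              (Mod.modulus-cong (pos-^ p 2) ([mod]⇒⟨mod⟩ (e-E2 i j ℓ)))

  x₀^[p-1]≡1 : ∀ i j ℓ → X i j ℓ 0 ^ (p ℕ.∸ 1) ≡ 1ℤ ⟨mod pℤ ⟩
  x₀^[p-1]≡1 i j ℓ = begin
    X i j ℓ 0 ^ (p ℕ.∸ 1)   ≈⟨ Mod.^-cong (p ℕ.∸ 1) (Mod.sym (≡-mod-p (elt (x i j ℓ)) 1)) ⟩
    X i j ℓ 1 ^ (p ℕ.∸ 1)   ≈⟨ Mod.weaken p∣p² (x^[p-1]≡1+pe i j ℓ 0) ⟩
    1ℤ + pℤ * e i j ℓ        ≡⟨ ≡.cong (_+_ 1ℤ) (ℤP.*-comm pℤ (e i j ℓ)) ⟩
    1ℤ + e i j ℓ * pℤ        ≈⟨ Mod.multiple 1ℤ (e i j ℓ) ⟩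
    1ℤ                       ∎
    where
    open ≡-mod-Reasoning pℤ
    p∣p² : pℤ ℤS.∣ pℤ ^ 2
    p∣p² = divides (pℤ * 1ℤ) (ℤP.*-comm pℤ (pℤ * 1ℤ))

  x^β≡c₀ : ∀ i j ℓ k β → + β ≡ α₁ ℓ ⟨mod + (p ℕ.∸ 1) ⟩ →
           X i j ℓ k ^ β ≡ c₀ i j ℓ ⟨mod pℤ ⟩
  x^β≡c₀ i j ℓ k β β≡α₁ =
    Mod.trans (Mod.^-cong β (≡-mod-p (elt (x i j ℓ)) k))
              (pow≡PowMod (x₀^[p-1]≡1 i j ℓ) (c₀-powMod i j ℓ) β≡α₁)

  -- Exponents are natural numbers, so that x ^ β is an ordinary power;
  -- α₁ ∈ ℤ only enters modulo p − 1.
  record Approximation (k : ℕ) : Set where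
    field
      β      : Fin n → ℕ
      solves : ∀ i → g i k β ≡ Y i k ⟨mod pℤ ^ suc k ⟩
      β≡α₁   : ∀ ℓ → + β ℓ ≡ α₁ ℓ ⟨mod + (p ℕ.∸ 1) ⟩

  open Approximation

  initial : Approximation 0
  initial = record { β = β₀ ; solves = solves₀ ; β≡α₁ = β₀≡α₁ }
    where
    β₀ : Fin n → ℕ
    β₀ ℓ = α₁ ℓ %ℕ (p ℕ.∸ 1)
    β₀≡α₁ : ∀ ℓ → + β₀ ℓ ≡ α₁ ℓ ⟨mod + (p ℕ.∸ 1) ⟩
    β₀≡α₁ ℓ = Mod.sym (α₁ ℓ /ℕ (p ℕ.∸ 1) , a≡a%ℕn+[a/ℕn]*n (α₁ ℓ) (p ℕ.∸ 1))
    solves₀ : ∀ i → g i 0 β₀ ≡ Y i 0 ⟨mod pℤ ^ 1 ⟩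
    solves₀ i = Mod.modulus-cong (≡.sym (ℤP.^-identityʳ pℤ)) (Mod.trans
      (Mod.Σ-cong (t i) (λ j → Mod.*-congˡ (A i j 0)
        (Mod.Π-cong n (λ ℓ → x^β≡c₀ i j ℓ 0 (β₀ ℓ) (β₀≡α₁ ℓ)))))
      ([mod]⇒⟨mod⟩ (g≡y-mod-p i)))

  module Lift {k} (s : Approximation k) where

    residual : ∀ i → g i (suc k) (β s) ≡ Y i (suc k) ⟨mod pℤ ^ suc k ⟩
    residual i = begin
      g i (suc k) (β s)
        ≈⟨ Mod.Σ-cong (t i) (λ j → Mod.*-cong (next (a i j))
             (Mod.Π-cong n (λ ℓ → Mod.^-cong (β s ℓ) (next (elt (x i j ℓ)))))) ⟩
      g i k (β s)        ≈⟨ solves s i ⟩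
      Y i k              ≈⟨ Mod.sym (next (y i)) ⟩
      Y i (suc k)        ∎
      where
      open ≡-mod-Reasoning (pℤ ^ suc k)
      next : ∀ (u : ℤp p) → seq u (suc k) ≡ seq u k ⟨mod pℤ ^ suc k ⟩
      next u = seq-≡-mod u (ℕ.≤′-step ℕ.≤′-refl)

    D : Fin m → ℤ
    D i = quotient (residual i)

    correction : ∃[ γ′ ] (∀ i → J i · γ′ ≡ - D i ⟨mod pℤ ⟩)
    correction = solve J J-rank (λ i → - D i)

    γ′ : Fin n → ℤ
    γ′ = proj₁ correction

    γ : Fin n → ℕ
    γ ℓ = γ′ ℓ %ℕ p

    Jγ≡-D : ∀ i → J i · (λ ℓ → + γ ℓ) ≡ - D i ⟨mod pℤ ⟩
    Jγ≡-D i = Mod.trans (Mod.Σ-cong n (λ ℓ → Mod.*-congˡ (J i ℓ) γ≡γ′)) (proj₂ correction i)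
      where
      γ≡γ′ : ∀ {ℓ} → + γ ℓ ≡ γ′ ℓ ⟨mod pℤ ⟩
      γ≡γ′ {ℓ} = Mod.sym (γ′ ℓ /ℕ p , a≡a%ℕn+[a/ℕn]*n (γ′ ℓ) p)

    β′ : Fin n → ℕ
    β′ ℓ = β s ℓ ℕ.+ p ℕ.^ k ℕ.* (p ℕ.∸ 1) ℕ.* γ ℓ

    β′≡β : ∀ ℓ → + β′ ℓ ≡ + β s ℓ ⟨mod + (p ℕ.^ k ℕ.* (p ℕ.∸ 1)) ⟩
    β′≡β ℓ = + γ ℓ , ≡.trans (pos-+* (β s ℓ) d (γ ℓ))
                             (≡.cong (_+_ (+ β s ℓ)) (ℤP.*-comm (+ d) (+ γ ℓ)))
      where
      d : ℕ
      d = p ℕ.^ k ℕ.* (p ℕ.∸ 1)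

    P : ℤ
    P = pℤ ^ suc k

    Σγe : (i : Fin m) → Fin (t i) → ℤ
    Σγe i j = Σ[ n ] (λ ℓ → + γ ℓ * e i j ℓ)

    term-expansion : ∀ i j →
      A i j (suc k) * Π[ n ] (λ ℓ → X i j ℓ (suc k) ^ β′ ℓ) ≡
      A i j (suc k) * Π[ n ] (λ ℓ → X i j ℓ (suc k) ^ β s ℓ) + P * (A i j 0 * Π[ n ] (c₀ i j) * Σγe i j)
      ⟨mod pℤ ^ suc (suc k) ⟩
    term-expansion i j = begin
      A′ * Π[ n ] (λ ℓ → X′ ℓ ^ β′ ℓ)
        ≈⟨ Mod.*-congˡ A′ (Mod.Π-cong n (λ ℓ →
             pow-+-p^k[p-1] (x^[p-1]≡1+pe i j ℓ k) k (β s ℓ) (γ ℓ))) ⟩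
      A′ * Π[ n ] (λ ℓ → X′ ℓ ^ β s ℓ * (1ℤ + P * (+ γ ℓ * e i j ℓ)))
        ≈⟨ Mod.*-congˡ A′ (Mod.weaken (x^[2+k]∣x^[1+k]² pℤ k)
             (Π-linear-mod-square P n (λ ℓ → X′ ℓ ^ β s ℓ) (λ ℓ → + γ ℓ * e i j ℓ))) ⟩
      A′ * (Πx^β * (1ℤ + P * Σγe i j))
        ≡⟨ lemma A′ Πx^β P (Σγe i j) ⟩
      A′ * Πx^β + P * (A′ * Πx^β * Σγe i j)
        ≈⟨ Mod.+-congˡ (A′ * Πx^β) (Mod.scale P first-order-mod-p) ⟩
      A′ * Πx^β + P * (A i j 0 * Π[ n ] (c₀ i j) * Σγe i j)  ∎
      where
      open ≡-mod-Reasoning (pℤ ^ suc (suc k))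
      A′ Πx^β : ℤ
      A′ = A i j (suc k)
      Πx^β = Π[ n ] (λ ℓ → X i j ℓ (suc k) ^ β s ℓ)
      X′ : Fin n → ℤ
      X′ ℓ = X i j ℓ (suc k)
      lemma : ∀ a π P s → a * (π * (1ℤ + P * s)) ≡ a * π + P * (a * π * s)
      lemma = solve-∀
      first-order-mod-p : A′ * Πx^β * Σγe i j ≡ A i j 0 * Π[ n ] (c₀ i j) * Σγe i j ⟨mod pℤ ⟩
      first-order-mod-p = Mod.*-congʳ (Σγe i j) (Mod.*-cong (≡-mod-p (a i j) (suc k))
        (Mod.Π-cong n (λ ℓ → x^β≡c₀ i j ℓ (suc k) (β s ℓ) (β≡α₁ s ℓ))))

    first-order≡Jγ : ∀ i →
      Σ[ t i ] (λ j → A i j 0 * Π[ n ] (c₀ i j) * Σγe i j) ≡ J i · (λ ℓ → + γ ℓ)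
    first-order≡Jγ i = begin
      Σ[ t i ] (λ j → A i j 0 * Π[ n ] (c₀ i j) * Σγe i j)
        ≡⟨ Σ-cong (t i) (λ j → *-distribˡ-Σ n (A i j 0 * Π[ n ] (c₀ i j)) _) ⟩
      Σ[ t i ] (λ j → Σ[ n ] (λ ℓ → A i j 0 * Π[ n ] (c₀ i j) * (+ γ ℓ * e i j ℓ)))
        ≡⟨ Σ-cong (t i) (λ j → Σ-cong n (λ ℓ →
             lemma (A i j 0) (Π[ n ] (c₀ i j)) (+ γ ℓ) (e i j ℓ))) ⟩
      Σ[ t i ] (λ j → Σ[ n ] (λ ℓ → A i j 0 * e i j ℓ * Π[ n ] (c₀ i j) * + γ ℓ))
        ≡⟨ Σ-comm (t i) n _ ⟩
      Σ[ n ] (λ ℓ → Σ[ t i ] (λ j → A i j 0 * e i j ℓ * Π[ n ] (c₀ i j) * + γ ℓ))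
        ≡⟨ Σ-cong n (λ ℓ → *-distribʳ-Σ (t i) (+ γ ℓ) _) ⟨
      J i · (λ ℓ → + γ ℓ)  ∎
      where
      open ≡-Reasoning
      lemma : ∀ a π g e → a * π * (g * e) ≡ a * e * π * g
      lemma = solve-∀

    lifted : ∀ i → g i (suc k) β′ ≡ Y i (suc k) ⟨mod pℤ ^ suc (suc k) ⟩
    lifted i = begin
      g i (suc k) β′
        ≈⟨ Mod.Σ-cong (t i) (term-expansion i) ⟩
      Σ[ t i ] (λ j → A i j (suc k) * Π[ n ] (λ ℓ → X i j ℓ (suc k) ^ β s ℓ) + P * v j)
        ≡⟨ Σ-distrib-+ (t i) _ _ ⟩
      g i (suc k) (β s) + Σ[ t i ] (λ j → P * v j)
        ≡⟨ ≡.cong (_+_ (g i (suc k) (β s))) (*-distribˡ-Σ (t i) P v) ⟨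
      g i (suc k) (β s) + P * Σ[ t i ] v
        ≡⟨ ≡.cong (λ z → g i (suc k) (β s) + P * z) (first-order≡Jγ i) ⟩
      g i (suc k) (β s) + P * J i · (λ ℓ → + γ ℓ)
        ≈⟨ Mod.+-congˡ (g i (suc k) (β s)) (Mod.scale P (Jγ≡-D i)) ⟩
      g i (suc k) (β s) + P * - D i
        ≡⟨ ≡.cong (_+ P * - D i) (equation (residual i)) ⟩
      Y i (suc k) + D i * P + P * - D i
        ≡⟨ lemma (Y i (suc k)) (D i) P ⟩
      Y i (suc k)  ∎
      where
      open ≡-mod-Reasoning (pℤ ^ suc (suc k))
      v : Fin (t i) → ℤ
      v j = A i j 0 * Π[ n ] (c₀ i j) * Σγe i j
      lemma : ∀ y d P → y + d * P + P * - d ≡ y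
      lemma = solve-∀

    next : Approximation (suc k)
    next = record
      { β      = β′
      ; solves = lifted
      ; β≡α₁   = λ ℓ → Mod.trans (Mod.weaken p-1∣φ (β′≡β ℓ)) (β≡α₁ s ℓ)
      }
      where
      p-1∣φ : + (p ℕ.∸ 1) ℤS.∣ + (p ℕ.^ k ℕ.* (p ℕ.∸ 1))
      p-1∣φ = divides (+ (p ℕ.^ k)) (ℤP.pos-* (p ℕ.^ k) (p ℕ.∸ 1))

  approximation : ∀ k → Approximation k
  approximation zero    = initial
  approximation (suc k) = Lift.next (approximation k)

  exponent : Fin n → ℕ → ℤ
  exponent ℓ zero    = α₁ ℓ
  exponent ℓ (suc k) = + β (approximation (suc k)) ℓ

  exponent-coherent : ∀ ℓ k → exponent ℓ (suc k) ≡ exponent ℓ k [mod φ (p ℕ.^ suc k) ]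
  exponent-coherent ℓ zero    = ≡.subst (λ d → exponent ℓ 1 ≡ α₁ ℓ [mod d ])
    (≡.sym (≡.trans (φ-prime-power 0) (ℕP.*-identityˡ (p ℕ.∸ 1))))
    (⟨mod⟩⇒[mod] (β≡α₁ (approximation 1) ℓ))
  exponent-coherent ℓ (suc k) =
    ≡.subst (λ d → exponent ℓ (suc (suc k)) ≡ exponent ℓ (suc k) [mod d ])
    (≡.sym (φ-prime-power (suc k)))
    (⟨mod⟩⇒[mod] (Lift.β′≡β (approximation (suc k)) ℓ))

  α : Fin n → 𝓔 p
  α ℓ = record { eseq = exponent ℓ ; ecoh = exponent-coherent ℓ }

  c : (i : Fin m) → Fin (t i) → Fin n → ℕ → ℤ
  c i j ℓ zero    = c₀ i j ℓ
  c i j ℓ (suc k) = X i j ℓ (suc k) ^ β (approximation (suc k)) ℓ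

  c-powMod : ∀ i j ℓ k → PowMod (p ℕ.^ suc k) (X i j ℓ k) (exponent ℓ k) (c i j ℓ k)
  c-powMod i j ℓ zero    =
    ≡.subst (λ d → PowMod d (X i j ℓ 0) (α₁ ℓ) (c₀ i j ℓ)) (≡.sym (ℕP.*-identityʳ p))
            (c₀-powMod i j ℓ)
  c-powMod i j ℓ (suc k) = ⟨mod⟩⇒[mod] (Mod.refl {a = c i j ℓ (suc k)})

  g[α]≡y : ∀ i k →
           Σ[ t i ] (λ j → A i j k * Π[ n ] (λ ℓ → c i j ℓ k)) ≡ Y i k [mod p ℕ.^ suc k ]
  g[α]≡y i zero    =
    ≡.subst (λ d → Σ[ t i ] (λ j → A i j 0 * Π[ n ] (c₀ i j)) ≡ Y i 0 [mod d ])
            (≡.sym (ℕP.*-identityʳ p)) (g≡y-mod-p i)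
  g[α]≡y i (suc k) =
    ⟨mod⟩⇒[mod] (Mod.modulus-cong (≡.sym (pos-^ p (suc (suc k)))) (solves (approximation (suc k)) i))

proposition2p12 :
    (p : ℕ) → Prime p → ¬ (2 ℕ.∣ p) →
    (m n : ℕ) → 1 ≤ m → m ≤ n →
    (t : Fin m → ℕ) →
    (a : (i : Fin m) → Fin (t i) → ℤp p) →
    (x : (i : Fin m) → Fin (t i) → Fin n → ℤpˣ p) →
    (y : Fin m → ℤp p) →
    (α₁ : Fin n → ℤ) →
    -- c₀ i j ℓ represents (x_j^(iℓ))^(α_ℓ1) modulo p
    (c₀ : (i : Fin m) → Fin (t i) → Fin n → ℤ) →
    (∀ i j ℓ → PowMod p (seq (elt (x i j ℓ)) 0) (α₁ ℓ) (c₀ i j ℓ)) →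
    -- e i j ℓ represents e₂(x_j2^(iℓ)) (second coordinate of x_j^(iℓ))
    (e : (i : Fin m) → Fin (t i) → Fin n → ℤ) →
    (∀ i j ℓ → E2 p (seq (elt (x i j ℓ)) 1) (e i j ℓ)) →
    -- (i) g(α₁) ≡ y (mod p)
    (∀ i → Σ[ t i ] (λ j → seq (a i j) 0 * Π[ n ] (λ ℓ → c₀ i j ℓ))
             ≡ seq (y i) 0 [mod p ]) →
    -- (ii) J_p g(α₁) has rank m over ℤ/pℤ
    HasRankModP p m n
      (λ i ℓ → Σ[ t i ] (λ j → seq (a i j) 0 * e i j ℓ
                                  * Π[ n ] (λ ℓ′ → c₀ i j ℓ′))) →
    -- conclusion: ∃ α ∈ 𝓔_p^n with first coordinates α_ℓ1 and g(α) = y in ℤ_p^m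
    Σ (Fin n → 𝓔 p) λ α →
      (∀ ℓ → eseq (α ℓ) 0 ≡ α₁ ℓ) ×
      Σ ((i : Fin m) → Fin (t i) → Fin n → ℕ → ℤ) λ c →
        (∀ i j ℓ k → PowMod (p ℕ.^ ℕ.suc k) (seq (elt (x i j ℓ)) k)
                            (eseq (α ℓ) k) (c i j ℓ k)) ×
        (∀ i k → Σ[ t i ] (λ j → seq (a i j) k * Π[ n ] (λ ℓ → c i j ℓ k))
                   ≡ seq (y i) k [mod p ℕ.^ ℕ.suc k ])
proposition2p12 p p-prime p-odd m n _ _ t a x y α₁ c₀ c₀-powMod e e-E2 g≡y-mod-p J-rank =
  α , (λ _ → ≡.refl) , c , c-powMod , g[α]≡y
  where
  open HenselLifting p p-prime p-odd m n t a x y α₁ c₀ c₀-powMod e e-E2 g≡y-mod-p J-rank
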